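{- Let $s,t,a,b$ be integers with $2\le a\le s$ and $2\le b\le t$. Then $$r\!\left(K_{n,n},K_{s,t},st-ab+2\right)\ge (1-o(1))\left(\frac{n}{\max\{a,b\}-1}\right)^{1/\min\{a,b\}},$$ where $o(1)$ denotes a quantity tending to $0$ as $n\to\infty$ (with $s,t,a,b$ fixed).
   Context: For graphs $G,H$ and an integer $q$ with $2\le q\le |E(H)|$, an $(H,q)$-coloring of $G$ is an edge-coloring of $G$ in which every subgraph of $G$ isomorphic to $H$ receives at least $q$ distinct colors; $r(G,H,q)$ is the minimum number of colors needed for $G$ to have an $(H,q)$-coloring. $K_{n,n}$, $K_{s,t}$ denote complete bipartite graphs. -}

module Defs where

open import Data.Nat using (ℕ; _+_; _*_; _∸_; _^_; _≤_; _⊔_; _⊓_)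
open import Data.Fin using (Fin)
open import Data.Sum using (_⊎_; inj₁; inj₂)
open import Data.Product using (_×_; _,_; Σ; ∃)
open import Data.Unit using (⊤)
open import Data.Empty using (⊥)
open import Function.Definitions using (Injective)
open import Relation.Binary.PropositionalEquality using (_≡_)

KV : ℕ → ℕ → Set
KV p q = Fin p ⊎ Fin q

KAdj : ∀ {p q} → KV p q → KV p q → Set
KAdj (inj₁ _) (inj₂ _) = ⊤
KAdj (inj₂ _) (inj₁ _) = ⊤
KAdj (inj₁ _) (inj₁ _) = ⊥
KAdj (inj₂ _) (inj₂ _) = ⊥

-- An edge-colouring of K_{n,n} with (at most) c colours: each edge
-- {left x, right y} gets colour χ x y.
EdgeColouring : ℕ → ℕ → Set
EdgeColouring n c = Fin n → Fin n → Fin c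

colourOf : ∀ {n c} → EdgeColouring n c → (u v : KV n n) → KAdj u v → Fin c
colourOf χ (inj₁ x) (inj₂ y) _ = χ x y
colourOf χ (inj₂ y) (inj₁ x) _ = χ x y

-- A subgraph of K_{n,n} isomorphic to K_{s,t}: an injective map on vertices
-- sending edges of K_{s,t} to edges of K_{n,n} (the copy is its image).
record Copy (s t n : ℕ) : Set where
  field
    φ     : KV s t → KV n n
    φ-inj : Injective _≡_ _≡_ φ
    φ-adj : (i : Fin s) (j : Fin t) → KAdj (φ (inj₁ i)) (φ (inj₂ j))

copyColour : ∀ {s t n c} → EdgeColouring n c → Copy s t n → Fin s × Fin t → Fin c
copyColour χ C (i , j) = colourOf χ (φ (inj₁ i)) (φ (inj₂ j)) (φ-adj i j)
  where open Copy C

AtLeastColours : ∀ {s t n c} → ℕ → EdgeColouring n c → Copy s t n → Set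
AtLeastColours {s} {t} q χ C =
  Σ (Fin q → Fin s × Fin t) λ g → Injective _≡_ _≡_ (λ k → copyColour χ C (g k))

IsColouring : (n s t q : ℕ) → ∀ {c} → EdgeColouring n c → Set
IsColouring n s t q χ = (C : Copy s t n) → AtLeastColours q χ C

-- K_{n,n} has a (K_{s,t}, q)-colouring using at most c colours.
-- r(K_{n,n}, K_{s,t}, q) is the least c for which this holds.
Colourable : (n s t q c : ℕ) → Set
Colourable n s t q c = Σ (EdgeColouring n c) (IsColouring n s t q)

-- A (K_{s,t}, st − ab + 2)-colouring of K_{n,n} has no monochromatic K_{a,b}:
-- a monochromatic K_{a,b} extends to a copy of K_{s,t}, and the ab edges of one
-- colour leave room for at most st − ab + 1 distinct colours among its edges.
-- For a colouring with c colours and no monochromatic K_{a,b}, double count the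
-- triples (a-tuple v of left vertices, right vertex y, colour i) with all edges
-- from v to y of colour i. Grouped by (y, i) this is Σ_y Σ_i deg_i(y)^a, which by
-- the power-mean inequality is at least n · n^a / c^(a−1). Grouped by v, a tuple
-- of distinct vertices has at most b − 1 such y per colour, while tuples with a
-- repeated entry (at most a² n^(a−1) of them) have at most n. Hence
-- n ≤ c^(a−1) (c (b−1) + a²); using it with min{a,b} on the tuple side gives the
-- asymptotic bound.

module Submission where

open import Defs
open import Data.Nat using (ℕ; _+_; _*_; _∸_; _^_; _≤_; _⊔_; _⊓_)
open import Data.Product using (Σ)

open import Data.Empty using (⊥-elim)
open import Data.Fin using (Fin; zero; suc; _↑ˡ_; _↑ʳ_; combine)
import Data.Fin.Properties as Finₚ
open import Data.Nat using (zero; suc; z≤n; s≤s; s≤s⁻¹; _<_; _≤?_)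
open import Data.Nat.Properties
open import Algebra.Properties.Semiring.Sum +-*-semiring
  using (sum; sum-syntax; sum-cong-≗; ∑-distrib-+; ∑-comm; *-distribˡ-sum; *-distribʳ-sum)
open import Data.Nat.Tactic.RingSolver using (solve-∀)
open import Data.Product using (_×_; _,_; proj₁; proj₂; ∃; ∃₂)
open import Data.Sum using (_⊎_; inj₁; inj₂)
open import Data.Sum.Properties using (inj₁-injective; inj₂-injective)
open import Data.Unit using (tt)
open import Data.Vec using (Vec; []; _∷_; lookup)
open import Data.Vec.Functional using () renaming (_∷_ to _◂_)
open import Function using (_∘_; flip)
open import Function.Definitions using (Injective)
open import Relation.Binary.PropositionalEquality
open import Relation.Nullary using (¬_; yes; no; contradiction)

sum-mono-≤ : ∀ {n} {f g : Fin n → ℕ} → (∀ i → f i ≤ g i) → sum f ≤ sum g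
sum-mono-≤ {zero}  _   = z≤n
sum-mono-≤ {suc n} f≤g = +-mono-≤ (f≤g zero) (sum-mono-≤ (f≤g ∘ suc))

∑-const : ∀ n k → ∑[ i < n ] k ≡ n * k
∑-const zero    k = refl
∑-const (suc n) k = cong (k +_) (∑-const n k)

sum-*-sum : ∀ {m n} (x : Fin m → ℕ) (y : Fin n → ℕ) →
  sum x * sum y ≡ ∑[ i < m ] ∑[ j < n ] (x i * y j)
sum-*-sum x y = trans (*-distribʳ-sum (sum y) x) (sum-cong-≗ λ i → *-distribˡ-sum (x i) y)

∑∑-distrib-+ : ∀ {m n} (f g : Fin m → Fin n → ℕ) →
  ∑[ i < m ] ∑[ j < n ] (f i j + g i j) ≡ ∑[ i < m ] ∑[ j < n ] f i j + ∑[ i < m ] ∑[ j < n ] g i j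
∑∑-distrib-+ f g = trans (sum-cong-≗ λ i → ∑-distrib-+ (f i) (g i)) (∑-distrib-+ (λ i → ∑[ j < _ ] f i j) (λ i → ∑[ j < _ ] g i j))

δ : ∀ {c} → Fin c → Fin c → ℕ
δ zero    zero    = 1
δ zero    (suc _) = 0
δ (suc _) zero    = 0
δ (suc i) (suc j) = δ i j

δ≤1 : ∀ {c} (i j : Fin c) → δ i j ≤ 1
δ≤1 zero    zero    = ≤-refl
δ≤1 zero    (suc _) = z≤n
δ≤1 (suc _) zero    = z≤n
δ≤1 (suc i) (suc j) = δ≤1 i j

δ-refl : ∀ {c} (i : Fin c) → δ i i ≡ 1
δ-refl zero    = refl
δ-refl (suc i) = δ-refl i

δ≡1⇒≡ : ∀ {c} (i j : Fin c) → δ i j ≡ 1 → i ≡ j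
δ≡1⇒≡ zero    zero    _  = refl
δ≡1⇒≡ (suc i) (suc j) eq = cong suc (δ≡1⇒≡ i j eq)

∑-zero : ∀ n → ∑[ i < n ] 0 ≡ 0
∑-zero n = trans (∑-const n 0) (*-zeroʳ n)

∑-δʳ : ∀ {c} (i : Fin c) → ∑[ j < c ] δ i j ≡ 1
∑-δʳ {suc c} zero    = cong suc (∑-zero c)
∑-δʳ {suc c} (suc i) = ∑-δʳ i

∑-δˡ : ∀ {c} (j : Fin c) → ∑[ i < c ] δ i j ≡ 1
∑-δˡ {suc c} zero    = cong suc (∑-zero c)
∑-δˡ {suc c} (suc j) = ∑-δˡ j

rearrangement : ∀ {u U v V} → u ≤ U → v ≤ V → u * V + U * v ≤ u * v + U * V
rearrangement {u} {_} {v} p q with m≤n⇒∃[o]m+o≡n p | m≤n⇒∃[o]m+o≡n q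
... | f , refl | e , refl = ≤-trans (m≤m+n _ (f * e)) (≤-reflexive (identity u f v e))
  where
  identity : ∀ u f v e → u * (v + e) + (u + f) * v + f * e ≡ u * v + (u + f) * (v + e)
  identity = solve-∀

chebyshev : ∀ c (x y : Fin c → ℕ) →
  (∀ i j → x i * y j + x j * y i ≤ x i * y i + x j * y j) →
  sum x * sum y ≤ c * ∑[ i < c ] (x i * y i)
chebyshev c x y similar = *-cancelˡ-≤ 2 (begin
  2 * (sum x * sum y)
    ≡⟨ double (sum x * sum y) ⟩
  sum x * sum y + sum x * sum y
    ≡⟨ cong₂ _+_ (sum-*-sum x y) (trans (sum-*-sum x y) (∑-comm (λ j i → x j * y i))) ⟩
  ∑[ i < c ] ∑[ j < c ] (x i * y j) + ∑[ i < c ] ∑[ j < c ] (x j * y i)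
    ≡⟨ ∑∑-distrib-+ (λ i j → x i * y j) (λ i j → x j * y i) ⟨
  ∑[ i < c ] ∑[ j < c ] (x i * y j + x j * y i)
    ≤⟨ sum-mono-≤ (λ i → sum-mono-≤ (similar i)) ⟩
  ∑[ i < c ] ∑[ j < c ] (x i * y i + x j * y j)
    ≡⟨ ∑∑-distrib-+ (λ i j → x i * y i) (λ i j → x j * y j) ⟩
  ∑[ i < c ] ∑[ j < c ] (x i * y i) + ∑[ i < c ] ∑[ j < c ] (x j * y j)
    ≡⟨ cong₂ _+_ (trans (sum-cong-≗ λ i → ∑-const c (x i * y i)) (sym (*-distribˡ-sum c (λ i → x i * y i))))
                 (∑-const c (∑[ j < c ] (x j * y j))) ⟩
  c * ∑[ i < c ] (x i * y i) + c * ∑[ i < c ] (x i * y i)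
    ≡⟨ double (c * ∑[ i < c ] (x i * y i)) ⟨
  2 * (c * ∑[ i < c ] (x i * y i)) ∎)
  where
  open ≤-Reasoning
  double : ∀ z → 2 * z ≡ z + z
  double z = cong (z +_) (+-identityʳ z)

similarly-ordered : ∀ k u v → u * v ^ k + v * u ^ k ≤ u * u ^ k + v * v ^ k
similarly-ordered k u v with ≤-total u v
... | inj₁ u≤v = rearrangement u≤v (^-monoˡ-≤ k u≤v)
... | inj₂ v≤u = subst₂ _≤_ (+-comm (v * u ^ k) (u * v ^ k)) (+-comm (v * v ^ k) (u * u ^ k))
  (rearrangement v≤u (^-monoˡ-≤ k v≤u))

power-mean : ∀ c (d : Fin c → ℕ) a → sum d ^ suc a ≤ c ^ a * ∑[ i < c ] (d i ^ suc a)
power-mean c d zero = ≤-reflexive (begin-equality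
  sum d * 1               ≡⟨ *-identityʳ _ ⟩
  sum d                   ≡⟨ sum-cong-≗ (λ i → *-identityʳ (d i)) ⟨
  ∑[ i < c ] (d i * 1)    ≡⟨ +-identityʳ _ ⟨
  1 * ∑[ i < c ] (d i * 1) ∎)
  where open ≤-Reasoning
power-mean c d (suc a) = begin
  sum d * sum d ^ suc a                          ≤⟨ *-monoʳ-≤ (sum d) (power-mean c d a) ⟩
  sum d * (c ^ a * ∑[ i < c ] (d i ^ suc a))     ≡⟨ x*[y*z]≡y*[x*z] (sum d) (c ^ a) _ ⟩
  c ^ a * (sum d * ∑[ i < c ] (d i ^ suc a))     ≤⟨ *-monoʳ-≤ (c ^ a) (chebyshev c d (λ i → d i ^ suc a)
                                                      λ i j → similarly-ordered (suc a) (d i) (d j)) ⟩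
  c ^ a * (c * ∑[ i < c ] (d i * d i ^ suc a))   ≡⟨ x*[y*z]≡y*[x*z] (c ^ a) c _ ⟩
  c * (c ^ a * ∑[ i < c ] (d i * d i ^ suc a))   ≡⟨ *-assoc c (c ^ a) _ ⟨
  c * c ^ a * ∑[ i < c ] (d i * d i ^ suc a)     ∎
  where
  open ≤-Reasoning
  x*[y*z]≡y*[x*z] : ∀ x y z → x * (y * z) ≡ y * (x * z)
  x*[y*z]≡y*[x*z] = solve-∀

∑ᵗ : ∀ {n} a → (Vec (Fin n) a → ℕ) → ℕ
∑ᵗ     zero    f = f []
∑ᵗ {n} (suc a) f = ∑[ x < n ] ∑ᵗ a (λ v → f (x ∷ v))

∏ : ∀ {n a} → (Fin n → ℕ) → Vec (Fin n) a → ℕ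
∏ g []      = 1
∏ g (x ∷ v) = g x * ∏ g v

module _ {n : ℕ} where

  ∑ᵗ-cong : ∀ a {f g : Vec (Fin n) a → ℕ} → (∀ v → f v ≡ g v) → ∑ᵗ a f ≡ ∑ᵗ a g
  ∑ᵗ-cong zero    f≡g = f≡g []
  ∑ᵗ-cong (suc a) f≡g = sum-cong-≗ λ x → ∑ᵗ-cong a (f≡g ∘ (x ∷_))

  ∑ᵗ-mono-≤ : ∀ a {f g : Vec (Fin n) a → ℕ} → (∀ v → f v ≤ g v) → ∑ᵗ a f ≤ ∑ᵗ a g
  ∑ᵗ-mono-≤ zero    f≤g = f≤g []
  ∑ᵗ-mono-≤ (suc a) f≤g = sum-mono-≤ λ x → ∑ᵗ-mono-≤ a (f≤g ∘ (x ∷_))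

  ∑ᵗ-distrib-+ : ∀ a (f g : Vec (Fin n) a → ℕ) → ∑ᵗ a (λ v → f v + g v) ≡ ∑ᵗ a f + ∑ᵗ a g
  ∑ᵗ-distrib-+ zero    f g = refl
  ∑ᵗ-distrib-+ (suc a) f g = trans (sum-cong-≗ λ x → ∑ᵗ-distrib-+ a (f ∘ (x ∷_)) (g ∘ (x ∷_)))
    (∑-distrib-+ (λ x → ∑ᵗ a (f ∘ (x ∷_))) (λ x → ∑ᵗ a (g ∘ (x ∷_))))

  *-distribˡ-∑ᵗ : ∀ a k (f : Vec (Fin n) a → ℕ) → k * ∑ᵗ a f ≡ ∑ᵗ a (λ v → k * f v)
  *-distribˡ-∑ᵗ zero    k f = refl
  *-distribˡ-∑ᵗ (suc a) k f = trans (*-distribˡ-sum k (λ x → ∑ᵗ a (f ∘ (x ∷_))))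
    (sum-cong-≗ λ x → *-distribˡ-∑ᵗ a k (f ∘ (x ∷_)))

  ∑ᵗ-const : ∀ a k → ∑ᵗ {n} a (λ _ → k) ≡ n ^ a * k
  ∑ᵗ-const zero    k = sym (+-identityʳ k)
  ∑ᵗ-const (suc a) k = begin
    ∑[ x < n ] ∑ᵗ {n} a (λ _ → k) ≡⟨ ∑-const n (∑ᵗ a (λ _ → k)) ⟩
    n * ∑ᵗ {n} a (λ _ → k)        ≡⟨ cong (n *_) (∑ᵗ-const a k) ⟩
    n * (n ^ a * k)               ≡⟨ *-assoc n (n ^ a) k ⟨
    n * n ^ a * k                 ∎
    where open ≡-Reasoning

  ∑ᵗ-comm : ∀ a {m} (f : Vec (Fin n) a → Fin m → ℕ) →
    ∑ᵗ a (λ v → ∑[ i < m ] f v i) ≡ ∑[ i < m ] ∑ᵗ a (λ v → f v i)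
  ∑ᵗ-comm zero    f = refl
  ∑ᵗ-comm (suc a) f = trans (sum-cong-≗ λ x → ∑ᵗ-comm a (f ∘ (x ∷_)))
    (∑-comm (λ x i → ∑ᵗ a (λ v → f (x ∷ v) i)))

  ∑ᵗ-∏ : ∀ a (g : Fin n → ℕ) → ∑ᵗ a (∏ g) ≡ sum g ^ a
  ∑ᵗ-∏ zero    g = refl
  ∑ᵗ-∏ (suc a) g = begin
    ∑[ x < n ] ∑ᵗ a (λ v → g x * ∏ g v) ≡⟨ sum-cong-≗ (λ x → *-distribˡ-∑ᵗ a (g x) (∏ g)) ⟨
    ∑[ x < n ] (g x * ∑ᵗ a (∏ g))       ≡⟨ sum-cong-≗ (λ x → cong (g x *_) (∑ᵗ-∏ a g)) ⟩
    ∑[ x < n ] (g x * sum g ^ a)        ≡⟨ *-distribʳ-sum (sum g ^ a) g ⟨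
    sum g * sum g ^ a                   ∎
    where open ≡-Reasoning

∏-≤1 : ∀ {n a} (g : Fin n → ℕ) → (∀ x → g x ≤ 1) → (v : Vec (Fin n) a) → ∏ g v ≤ 1
∏-≤1 g g≤1 []      = ≤-refl
∏-≤1 g g≤1 (x ∷ v) = *-mono-≤ (g≤1 x) (∏-≤1 g g≤1 v)

∏≡1⇒≡1 : ∀ {n a} (g : Fin n → ℕ) (v : Vec (Fin n) a) → ∏ g v ≡ 1 → ∀ j → g (lookup v j) ≡ 1
∏≡1⇒≡1 g (x ∷ v) eq zero    = m*n≡1⇒m≡1 (g x) (∏ g v) eq
∏≡1⇒≡1 g (x ∷ v) eq (suc j) = ∏≡1⇒≡1 g v (m*n≡1⇒n≡1 (g x) (∏ g v) eq) j

module _ {n : ℕ} where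

  occurrences : ∀ {a} → Fin n → Vec (Fin n) a → ℕ
  occurrences x []      = 0
  occurrences x (y ∷ w) = δ x y + occurrences x w

  collisions : ∀ {a} → Vec (Fin n) a → ℕ
  collisions []      = 0
  collisions (x ∷ w) = occurrences x w + collisions w

  ∑-occurrences : ∀ {a} (w : Vec (Fin n) a) → ∑[ x < n ] occurrences x w ≡ a
  ∑-occurrences []      = ∑-zero n
  ∑-occurrences (y ∷ w) =
    trans (∑-distrib-+ (λ x → δ x y) (λ x → occurrences x w)) (cong₂ _+_ (∑-δˡ y) (∑-occurrences w))

  ∑ᵗ-collisions : ∀ a → n * ∑ᵗ a collisions ≤ a * a * n ^ a
  ∑ᵗ-collisions zero    = ≤-reflexive (*-zeroʳ n)
  ∑ᵗ-collisions (suc a) = begin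
    n * ∑[ x < n ] ∑ᵗ a (λ w → occurrences x w + collisions w)
      ≡⟨ cong (n *_) (trans (sum-cong-≗ λ x → ∑ᵗ-distrib-+ a (occurrences x) collisions)
                            (∑-distrib-+ (λ x → ∑ᵗ a (occurrences x)) (λ _ → ∑ᵗ a collisions))) ⟩
    n * (∑[ x < n ] ∑ᵗ a (occurrences x) + ∑[ x < n ] ∑ᵗ a collisions)
      ≡⟨ cong₂ (λ p q → n * (p + q)) first-entry (∑-const n (∑ᵗ a collisions)) ⟩
    n * (n ^ a * a + n * ∑ᵗ a collisions)
      ≤⟨ *-monoʳ-≤ n (+-monoʳ-≤ (n ^ a * a) (∑ᵗ-collisions a)) ⟩
    n * (n ^ a * a + a * a * n ^ a)
      ≡⟨ regroup n (n ^ a) a ⟩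
    (a + a * a) * (n * n ^ a)
      ≤⟨ *-monoˡ-≤ (n * n ^ a) (≤-trans (m≤n+m (a + a * a) (suc a)) (≤-reflexive (square a))) ⟩
    suc a * suc a * (n * n ^ a) ∎
    where
    open ≤-Reasoning
    first-entry : ∑[ x < n ] ∑ᵗ a (occurrences x) ≡ n ^ a * a
    first-entry = trans (sym (∑ᵗ-comm a λ w x → occurrences x w))
                        (trans (∑ᵗ-cong a ∑-occurrences) (∑ᵗ-const a a))
    regroup : ∀ n p a → n * (p * a + a * a * p) ≡ (a + a * a) * (n * p)
    regroup = solve-∀
    square : ∀ a → suc a + (a + a * a) ≡ suc a * suc a
    square = solve-∀

  occurrences≡0⇒∉ : ∀ {a} (x : Fin n) (w : Vec (Fin n) a) → occurrences x w ≡ 0 → ∀ j → x ≢ lookup w j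
  occurrences≡0⇒∉ x (y ∷ w) eq zero refl = 1+n≢0 (trans (cong (_+ occurrences x w) (sym (δ-refl x))) eq)
  occurrences≡0⇒∉ x (y ∷ w) eq (suc j)   = occurrences≡0⇒∉ x w (m+n≡0⇒n≡0 (δ x y) eq) j

  collisions≡0⇒injective : ∀ {a} (v : Vec (Fin n) a) → collisions v ≡ 0 → Injective _≡_ _≡_ (lookup v)
  collisions≡0⇒injective (x ∷ w) eq {zero}  {zero}  _ = refl
  collisions≡0⇒injective (x ∷ w) eq {zero}  {suc j} e =
    contradiction e (occurrences≡0⇒∉ x w (m+n≡0⇒m≡0 (occurrences x w) eq) j)
  collisions≡0⇒injective (x ∷ w) eq {suc i} {zero}  e =
    contradiction (sym e) (occurrences≡0⇒∉ x w (m+n≡0⇒m≡0 (occurrences x w) eq) i)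
  collisions≡0⇒injective (x ∷ w) eq {suc i} {suc j} e =
    cong suc (collisions≡0⇒injective w (m+n≡0⇒n≡0 (occurrences x w) eq) e)

◂-injective : ∀ {m n} {z : Fin n} {f : Fin m → Fin n} →
  (∀ j → f j ≢ z) → Injective _≡_ _≡_ f → Injective _≡_ _≡_ (z ◂ f)
◂-injective z∉f f-inj {zero}  {zero}  _ = refl
◂-injective z∉f f-inj {zero}  {suc j} e = contradiction (sym e) (z∉f j)
◂-injective z∉f f-inj {suc i} {zero}  e = contradiction e (z∉f i)
◂-injective z∉f f-inj {suc i} {suc j} e = cong suc (f-inj e)

∃-∉-image : ∀ {m n} → m < n → (f : Fin m → Fin n) → ∃ λ z → ∀ j → f j ≢ z
∃-∉-image {m} {n} m<n f with Finₚ.all? (λ z → Finₚ.any? (λ j → f j Finₚ.≟ z))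
... | yes surjective = contradiction (Finₚ.injective⇒≤ section-injective) (<⇒≱ m<n)
  where
  section-injective : Injective _≡_ _≡_ (proj₁ ∘ surjective)
  section-injective {z} {z′} e =
    trans (sym (proj₂ (surjective z))) (trans (cong f e) (proj₂ (surjective z′)))
... | no ¬surjective
  with z , z∉image ← Finₚ.¬∀⟶∃¬ n _ (λ z → Finₚ.any? (λ j → f j Finₚ.≟ z)) ¬surjective =
  z , λ j fj≡z → z∉image (j , fj≡z)

extend-injection : ∀ d {a n} (x : Fin a → Fin n) → Injective _≡_ _≡_ x → d + a ≤ n →
  Σ (Fin (d + a) → Fin n) λ X → Injective _≡_ _≡_ X × (∀ j → X (d ↑ʳ j) ≡ x j)
extend-injection zero    x x-inj _ = x , x-inj , λ _ → refl
extend-injection (suc d) x x-inj d+a<n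
  with X , X-inj , X-extends ← extend-injection d x x-inj (<⇒≤ d+a<n)
  with z , z∉X ← ∃-∉-image d+a<n X
  = z ◂ X , ◂-injective z∉X X-inj , X-extends

support-injection : ∀ {n} (f : Fin n → ℕ) → (∀ x → f x ≤ 1) → ∀ {b} → b ≤ sum f →
  Σ (Fin b → Fin n) λ Y → Injective _≡_ _≡_ Y × (∀ j → f (Y j) ≡ 1)
support-injection f _ {zero} _ = (λ ()) , (λ { {()} }) , (λ ())
support-injection {zero} f _ {suc b} ()
support-injection {suc n} f f≤1 {suc b} b≤ with f zero in f₀ | f≤1 zero
... | 0 | _ with Y , Y-inj , Y-supp ← support-injection (f ∘ suc) (f≤1 ∘ suc) b≤ =
  suc ∘ Y , Y-inj ∘ Finₚ.suc-injective , Y-supp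
... | 1 | _ with Y , Y-inj , Y-supp ← support-injection (f ∘ suc) (f≤1 ∘ suc) (s≤s⁻¹ b≤) =
  zero ◂ (suc ∘ Y) , ◂-injective (λ _ ()) (Y-inj ∘ Finₚ.suc-injective) , λ { zero → f₀ ; (suc j) → Y-supp j }
... | suc (suc _) | s≤s ()

record MonochromaticBiclique {n c} (χ : EdgeColouring n c) (a b : ℕ) : Set where
  field
    left          : Fin a → Fin n
    left-inj      : Injective _≡_ _≡_ left
    right         : Fin b → Fin n
    right-inj     : Injective _≡_ _≡_ right
    colour        : Fin c
    monochromatic : ∀ p q → χ (left p) (right q) ≡ colour

transpose : ∀ {n c a b} {χ : EdgeColouring n c} →
  MonochromaticBiclique (flip χ) b a → MonochromaticBiclique χ a b
transpose K = record
  { left = right ; left-inj = right-inj ; right = left ; right-inj = left-inj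
  ; colour = colour ; monochromatic = flip monochromatic }
  where open MonochromaticBiclique K

*-cancelʳ-≤-^ : ∀ m n k → m * m ^ k ≤ n * m ^ k → m ≤ n
*-cancelʳ-≤-^ zero    n k _  = z≤n
*-cancelʳ-≤-^ (suc m) n k le = *-cancelʳ-≤ (suc m) n (suc m ^ k) {{m^n≢0 (suc m) k}} le

bicliqueBound : ℕ → ℕ → ℕ → ℕ
bicliqueBound a L c = c ^ (a ∸ 1) * (c * L + a * a)

module BicliqueFree {n c a b} (χ : EdgeColouring n c)
                    (free : ¬ MonochromaticBiclique χ (suc a) b) where

  degree : Fin n → Fin c → ℕ
  degree y i = ∑[ x < n ] δ (χ x y) i

  ∑-degree : ∀ y → ∑[ i < c ] degree y i ≡ n
  ∑-degree y = begin
    ∑[ i < c ] ∑[ x < n ] δ (χ x y) i ≡⟨ ∑-comm (λ i x → δ (χ x y) i) ⟩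
    ∑[ x < n ] ∑[ i < c ] δ (χ x y) i ≡⟨ sum-cong-≗ (λ x → ∑-δʳ (χ x y)) ⟩
    ∑[ x < n ] 1                      ≡⟨ ∑-const n 1 ⟩
    n * 1                             ≡⟨ *-identityʳ n ⟩
    n                                 ∎
    where open ≡-Reasoning

  star : Vec (Fin n) (suc a) → Fin n → Fin c → ℕ
  star v y i = ∏ (λ x → δ (χ x y) i) v

  stars : ℕ
  stars = ∑[ y < n ] ∑[ i < c ] ∑ᵗ (suc a) (λ v → star v y i)

  stars-lower : n * n ^ suc a ≤ c ^ a * stars
  stars-lower = begin
    n * n ^ suc a           ≡⟨ ∑-const n (n ^ suc a) ⟨
    ∑[ y < n ] (n ^ suc a)  ≤⟨ sum-mono-≤ stars-at ⟩
    ∑[ y < n ] (c ^ a * ∑[ i < c ] ∑ᵗ (suc a) (λ v → star v y i))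
      ≡⟨ *-distribˡ-sum (c ^ a) (λ y → ∑[ i < c ] ∑ᵗ (suc a) (λ v → star v y i)) ⟨
    c ^ a * stars           ∎
    where
    open ≤-Reasoning
    stars-at : ∀ y → n ^ suc a ≤ c ^ a * ∑[ i < c ] ∑ᵗ (suc a) (λ v → star v y i)
    stars-at y = begin
      n ^ suc a                                   ≡⟨ cong (_^ suc a) (∑-degree y) ⟨
      sum (degree y) ^ suc a                      ≤⟨ power-mean c (degree y) a ⟩
      c ^ a * ∑[ i < c ] (degree y i ^ suc a)
        ≡⟨ cong (c ^ a *_) (sum-cong-≗ λ i → ∑ᵗ-∏ (suc a) (λ x → δ (χ x y) i)) ⟨
      c ^ a * ∑[ i < c ] ∑ᵗ (suc a) (λ v → star v y i) ∎

  commonNeighbours : Vec (Fin n) (suc a) → ℕ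
  commonNeighbours v = ∑[ i < c ] ∑[ y < n ] star v y i

  stars≡∑ᵗ-commonNeighbours : stars ≡ ∑ᵗ (suc a) commonNeighbours
  stars≡∑ᵗ-commonNeighbours = begin
    ∑[ y < n ] ∑[ i < c ] ∑ᵗ (suc a) (λ v → star v y i)
      ≡⟨ sum-cong-≗ (λ y → ∑ᵗ-comm (suc a) (λ v i → star v y i)) ⟨
    ∑[ y < n ] ∑ᵗ (suc a) (λ v → ∑[ i < c ] star v y i)
      ≡⟨ ∑ᵗ-comm (suc a) (λ v y → ∑[ i < c ] star v y i) ⟨
    ∑ᵗ (suc a) (λ v → ∑[ y < n ] ∑[ i < c ] star v y i)
      ≡⟨ ∑ᵗ-cong (suc a) (λ v → ∑-comm (λ y i → star v y i)) ⟩
    ∑ᵗ (suc a) commonNeighbours ∎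
    where open ≡-Reasoning

  star≤1 : ∀ v y i → star v y i ≤ 1
  star≤1 v y i = ∏-≤1 _ (λ x → δ≤1 (χ x y) i) v

  commonNeighbours≤n : ∀ v → commonNeighbours v ≤ n
  commonNeighbours≤n (x ∷ w) = begin
    ∑[ i < c ] ∑[ y < n ] star (x ∷ w) y i ≡⟨ ∑-comm (λ i y → star (x ∷ w) y i) ⟩
    ∑[ y < n ] ∑[ i < c ] star (x ∷ w) y i ≤⟨ sum-mono-≤ (λ y → sum-mono-≤ λ i → first-edge y i) ⟩
    ∑[ y < n ] ∑[ i < c ] δ (χ x y) i       ≡⟨ sum-cong-≗ (λ y → ∑-δʳ (χ x y)) ⟩
    ∑[ y < n ] 1                            ≡⟨ trans (∑-const n 1) (*-identityʳ n) ⟩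
    n                                       ∎
    where
    open ≤-Reasoning
    first-edge : ∀ y i → star (x ∷ w) y i ≤ δ (χ x y) i
    first-edge y i = ≤-trans (*-monoʳ-≤ (δ (χ x y) i) (∏-≤1 _ (λ z → δ≤1 (χ z y) i) w))
                             (≤-reflexive (*-identityʳ _))

  commonNeighbours-injective : ∀ v → Injective _≡_ _≡_ (lookup v) → commonNeighbours v ≤ c * (b ∸ 1)
  commonNeighbours-injective v v-inj =
    ≤-trans (sum-mono-≤ fewer-than-b) (≤-reflexive (∑-const c (b ∸ 1)))
    where
    fewer-than-b : ∀ i → ∑[ y < n ] star v y i ≤ b ∸ 1
    fewer-than-b i with ∑[ y < n ] star v y i ≤? b ∸ 1
    ... | yes few = few
    ... | no ¬few
      with Y , Y-inj , Y-star ← support-injection (λ y → star v y i) (λ y → star≤1 v y i)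
                                  (≤-trans (m≤n+m∸n b 1) (≰⇒> ¬few))
      = ⊥-elim (free record
          { left = lookup v ; left-inj = v-inj ; right = Y ; right-inj = Y-inj ; colour = i
          ; monochromatic = λ p q → δ≡1⇒≡ _ i (∏≡1⇒≡1 _ v (Y-star q) p) })

  commonNeighbours-bound : ∀ v → commonNeighbours v ≤ c * (b ∸ 1) + n * collisions v
  commonNeighbours-bound v with collisions v in none
  ... | zero  = ≤-trans (commonNeighbours-injective v (collisions≡0⇒injective v none)) (m≤m+n _ _)
  ... | suc k = ≤-trans (commonNeighbours≤n v) (≤-trans (m≤m*n n (suc k)) (m≤n+m _ _))

  stars-upper : stars ≤ n ^ suc a * (c * (b ∸ 1)) + suc a * suc a * n ^ suc a
  stars-upper = begin
    stars                                                         ≡⟨ stars≡∑ᵗ-commonNeighbours ⟩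
    ∑ᵗ (suc a) commonNeighbours                                   ≤⟨ ∑ᵗ-mono-≤ (suc a) commonNeighbours-bound ⟩
    ∑ᵗ {n} (suc a) (λ v → c * (b ∸ 1) + n * collisions v)
      ≡⟨ ∑ᵗ-distrib-+ {n} (suc a) (λ _ → c * (b ∸ 1)) (λ v → n * collisions v) ⟩
    ∑ᵗ {n} (suc a) (λ _ → c * (b ∸ 1)) + ∑ᵗ {n} (suc a) (λ v → n * collisions v)
      ≡⟨ cong₂ _+_ (∑ᵗ-const {n} (suc a) (c * (b ∸ 1))) (sym (*-distribˡ-∑ᵗ {n} (suc a) n collisions)) ⟩
    n ^ suc a * (c * (b ∸ 1)) + n * ∑ᵗ {n} (suc a) collisions     ≤⟨ +-monoʳ-≤ _ (∑ᵗ-collisions {n} (suc a)) ⟩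
    n ^ suc a * (c * (b ∸ 1)) + suc a * suc a * n ^ suc a         ∎
    where open ≤-Reasoning

  bound : n ≤ bicliqueBound (suc a) (b ∸ 1) c
  bound = *-cancelʳ-≤-^ n _ (suc a) (begin
    n * n ^ suc a                                                   ≤⟨ stars-lower ⟩
    c ^ a * stars                                                   ≤⟨ *-monoʳ-≤ (c ^ a) stars-upper ⟩
    c ^ a * (n ^ suc a * (c * (b ∸ 1)) + suc a * suc a * n ^ suc a) ≡⟨ factor (c ^ a) (n ^ suc a) _ _ ⟩
    bicliqueBound (suc a) (b ∸ 1) c * n ^ suc a                     ∎)
    where
    open ≤-Reasoning
    factor : ∀ p q x y → p * (q * x + y * q) ≡ p * (x + y) * q
    factor = solve-∀

data SplitView (m k : ℕ) : Fin (m + k) → Set where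
  inˡ : (i : Fin m) → SplitView m k (i ↑ˡ k)
  inʳ : (j : Fin k) → SplitView m k (m ↑ʳ j)

splitView : ∀ m {k} (i : Fin (m + k)) → SplitView m k i
splitView zero    i       = inʳ i
splitView (suc m) zero    = inˡ zero
splitView (suc m) (suc i) with splitView m i
... | inˡ i′ = inˡ (suc i′)
... | inʳ j  = inʳ j

↑ˡ≢↑ʳ : ∀ m {k} (i : Fin m) (j : Fin k) → i ↑ˡ k ≢ m ↑ʳ j
↑ˡ≢↑ʳ (suc m) (suc i) j eq = ↑ˡ≢↑ʳ m i j (Finₚ.suc-injective eq)

data EdgeView (ds a dt b : ℕ) : Fin (ds + a) × Fin (dt + b) → Set where
  outerRow : (p : Fin ds) (r : Fin (dt + b)) → EdgeView ds a dt b (p ↑ˡ a , r)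
  outerCol : (p : Fin a) (r : Fin dt) → EdgeView ds a dt b (ds ↑ʳ p , r ↑ˡ b)
  block    : (p : Fin a) (r : Fin b) → EdgeView ds a dt b (ds ↑ʳ p , dt ↑ʳ r)

module _ {ds a dt b : ℕ} where

  edgeView : (e : Fin (ds + a) × Fin (dt + b)) → EdgeView ds a dt b e
  edgeView (p , r) with splitView ds p | splitView dt r
  ... | inˡ p′ | _      = outerRow p′ r
  ... | inʳ p′ | inˡ r′ = outerCol p′ r′
  ... | inʳ p′ | inʳ r′ = block p′ r′

  InBlock : Fin (ds + a) × Fin (dt + b) → Set
  InBlock e = ∃₂ λ p r → e ≡ (ds ↑ʳ p , dt ↑ʳ r)

  collapse : ∀ {e} → EdgeView ds a dt b e → Fin (suc (a * dt + ds * (dt + b)))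
  collapse (outerRow p r) = suc (a * dt ↑ʳ combine p r)
  collapse (outerCol p r) = suc (combine p r ↑ˡ ds * (dt + b))
  collapse (block _ _)    = zero

  collapse-injective : ∀ {e e′} (u : EdgeView ds a dt b e) (v : EdgeView ds a dt b e′) →
    collapse u ≡ collapse v → e ≡ e′ ⊎ (InBlock e × InBlock e′)
  collapse-injective (outerRow p r) (outerRow p′ r′) eq
    with refl , refl ← Finₚ.combine-injective p r p′ r′ (Finₚ.↑ʳ-injective _ _ _ (Finₚ.suc-injective eq)) =
    inj₁ refl
  collapse-injective (outerRow p r) (outerCol p′ r′) eq =
    contradiction (sym (Finₚ.suc-injective eq)) (↑ˡ≢↑ʳ _ _ _)
  collapse-injective (outerCol p r) (outerRow p′ r′) eq =
    contradiction (Finₚ.suc-injective eq) (↑ˡ≢↑ʳ _ _ _)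
  collapse-injective (outerCol p r) (outerCol p′ r′) eq
    with refl , refl ← Finₚ.combine-injective p r p′ r′ (Finₚ.↑ˡ-injective _ _ _ (Finₚ.suc-injective eq)) =
    inj₁ refl
  collapse-injective (block p r) (block p′ r′) _ = inj₂ ((p , r , refl) , (p′ , r′ , refl))

  edge-count : (ds + a) * (dt + b) ∸ a * b + 2 ≡ suc (suc (a * dt + ds * (dt + b)))
  edge-count = begin
    (ds + a) * (dt + b) ∸ a * b + 2               ≡⟨ cong (λ z → z ∸ a * b + 2) (expand ds a dt b) ⟩
    a * dt + ds * (dt + b) + a * b ∸ a * b + 2    ≡⟨ cong (_+ 2) (m+n∸n≡m _ (a * b)) ⟩
    a * dt + ds * (dt + b) + 2                    ≡⟨ +-comm _ 2 ⟩
    suc (suc (a * dt + ds * (dt + b)))            ∎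
    where
    open ≡-Reasoning
    expand : ∀ ds a dt b → (ds + a) * (dt + b) ≡ a * dt + ds * (dt + b) + a * b
    expand = solve-∀

  constant-on-block⇒¬injective : ∀ {C : Set} (f : Fin (ds + a) × Fin (dt + b) → C) {i : C} →
    (∀ p r → f (ds ↑ʳ p , dt ↑ʳ r) ≡ i) →
    (g : Fin ((ds + a) * (dt + b) ∸ a * b + 2) → Fin (ds + a) × Fin (dt + b)) →
    ¬ Injective _≡_ _≡_ (f ∘ g)
  constant-on-block⇒¬injective f f-block g fg-inj
    with k₁ , k₂ , k₁<k₂ , same ← Finₚ.pigeonhole (≤-reflexive (sym edge-count)) (collapse ∘ edgeView ∘ g)
    with collapse-injective (edgeView (g k₁)) (edgeView (g k₂)) same
  ... | inj₁ g≡ = Finₚ.<⇒≢ k₁<k₂ (fg-inj (cong f g≡))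
  ... | inj₂ ((p , r , g₁≡) , (p′ , r′ , g₂≡)) =
    Finₚ.<⇒≢ k₁<k₂ (fg-inj (trans (cong f g₁≡) (trans (f-block p r) (sym (trans (cong f g₂≡) (f-block p′ r′))))))

≤⇒∃[d]d+m≡n : ∀ {m n} → m ≤ n → ∃ λ d → d + m ≡ n
≤⇒∃[d]d+m≡n {m} m≤n with d , m+d≡n ← m≤n⇒∃[o]m+o≡n m≤n = d , trans (+-comm d m) m+d≡n

bicliqueCopy : ∀ {s t n} (X : Fin s → Fin n) → Injective _≡_ _≡_ X →
  (Y : Fin t → Fin n) → Injective _≡_ _≡_ Y → Copy s t n
bicliqueCopy {s} {t} {n} X X-inj Y Y-inj = record { φ = φ ; φ-inj = φ-inj ; φ-adj = λ _ _ → tt }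
  where
  φ : KV s t → KV n n
  φ (inj₁ p) = inj₁ (X p)
  φ (inj₂ r) = inj₂ (Y r)
  φ-inj : Injective _≡_ _≡_ φ
  φ-inj {inj₁ _} {inj₁ _} eq = cong inj₁ (X-inj (inj₁-injective eq))
  φ-inj {inj₂ _} {inj₂ _} eq = cong inj₂ (Y-inj (inj₂-injective eq))

colouring⇒biclique-free : ∀ {n s t a b c} {χ : EdgeColouring n c} → a ≤ s → b ≤ t → s ≤ n → t ≤ n →
  IsColouring n s t (s * t ∸ a * b + 2) χ → ¬ MonochromaticBiclique χ a b
colouring⇒biclique-free {χ = χ} a≤s b≤t s≤n t≤n colouring
  record { left = x ; left-inj = x-inj ; right = y ; right-inj = y-inj ; colour = i ; monochromatic = mono }
  with ds , refl ← ≤⇒∃[d]d+m≡n a≤s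
  with dt , refl ← ≤⇒∃[d]d+m≡n b≤t
  with X , X-inj , X-extends ← extend-injection ds x x-inj s≤n
  with Y , Y-inj , Y-extends ← extend-injection dt y y-inj t≤n
  with g , distinct ← colouring (bicliqueCopy X X-inj Y Y-inj)
  = constant-on-block⇒¬injective (copyColour χ (bicliqueCopy X X-inj Y Y-inj))
      (λ p r → trans (cong₂ χ (X-extends p) (Y-extends r)) (mono p r)) g distinct

biclique-free⇒≤bicliqueBound : ∀ {n c a b} (χ : EdgeColouring n c) → 1 ≤ a →
  ¬ MonochromaticBiclique χ a b → n ≤ bicliqueBound a (b ∸ 1) c
biclique-free⇒≤bicliqueBound χ (s≤s z≤n) free = BicliqueFree.bound χ free

biclique-free⇒≤bicliqueBound-⊓⊔ : ∀ {n c a b} (χ : EdgeColouring n c) → 1 ≤ a → 1 ≤ b →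
  ¬ MonochromaticBiclique χ a b → n ≤ bicliqueBound (a ⊓ b) ((a ⊔ b) ∸ 1) c
biclique-free⇒≤bicliqueBound-⊓⊔ {a = a} {b} χ 1≤a 1≤b free with ≤-total a b
... | inj₁ a≤b rewrite m≤n⇒m⊓n≡m a≤b | m≤n⇒m⊔n≡n a≤b =
  biclique-free⇒≤bicliqueBound χ 1≤a free
... | inj₂ b≤a rewrite m≥n⇒m⊓n≡n b≤a | m≥n⇒m⊔n≡m b≤a =
  biclique-free⇒≤bicliqueBound (flip χ) 1≤b (free ∘ transpose)

bicliqueBound-mono : ∀ a L {c c′} → c ≤ c′ → bicliqueBound a L c ≤ bicliqueBound a L c′
bicliqueBound-mono a L c≤c′ = *-mono-≤ (^-monoˡ-≤ (a ∸ 1) c≤c′) (+-monoˡ-≤ (a * a) (*-monoˡ-≤ L c≤c′))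

-- Once k m² ≤ c L, the additive m² costs at most a factor (k+1)/k ≤ ((k+1)/k)^m.
k^m*bicliqueBound≤ : ∀ m L c k → k * suc m * suc m ≤ c * L →
  k ^ suc m * bicliqueBound (suc m) L c ≤ (k + 1) ^ suc m * L * c ^ suc m
k^m*bicliqueBound≤ m L c k km²≤cL = begin
  k * X * (Y * (c * L + suc m * suc m))              ≡⟨ spread k X Y c L (suc m) ⟩
  k * X * L * (c * Y) + X * Y * (k * suc m * suc m)  ≤⟨ +-monoʳ-≤ _ (*-monoʳ-≤ (X * Y) km²≤cL) ⟩
  k * X * L * (c * Y) + X * Y * (c * L)              ≡⟨ collect k X Y c L ⟩
  (k + 1) * X * L * (c * Y)                          ≤⟨ *-monoˡ-≤ (c * Y) (*-monoˡ-≤ L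
                                                          (*-monoʳ-≤ (k + 1) (^-monoˡ-≤ m (m≤m+n k 1)))) ⟩
  (k + 1) * (k + 1) ^ m * L * (c * Y)                ∎
  where
  open ≤-Reasoning
  X Y : ℕ
  X = k ^ m
  Y = c ^ m
  spread : ∀ k X Y c L m → k * X * (Y * (c * L + m * m)) ≡ k * X * L * (c * Y) + X * Y * (k * m * m)
  spread = solve-∀
  collect : ∀ k X Y c L → k * X * L * (c * Y) + X * Y * (c * L) ≡ (k + 1) * X * L * (c * Y)
  collect = solve-∀

eventually-bound : ∀ {m L n c} k → 1 ≤ m → 1 ≤ L → n ≤ bicliqueBound m L c →
  bicliqueBound m L (k * m * m) < n → k ^ m * n ≤ (k + 1) ^ m * L * c ^ m
eventually-bound {suc m} {suc L} {c = c} k _ _ n≤bound threshold<n with k * suc m * suc m ≤? c * suc L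
... | yes km²≤cL = ≤-trans (*-monoʳ-≤ (k ^ suc m) n≤bound) (k^m*bicliqueBound≤ m (suc L) c k km²≤cL)
... | no  km²≰cL = contradiction (≤-trans n≤bound (bicliqueBound-mono (suc m) (suc L) c≤km²)) (<⇒≱ threshold<n)
  where
  c≤km² : c ≤ k * suc m * suc m
  c≤km² = ≤-trans (m≤m*n c (suc L)) (<⇒≤ (≰⇒> km²≰cL))

theorem7p1 : (s t a b : ℕ) → 2 ≤ a → a ≤ s → 2 ≤ b → b ≤ t →
    (k : ℕ) → Σ ℕ λ N → (n : ℕ) → N ≤ n → (c : ℕ) →
      Colourable n s t (s * t ∸ a * b + 2) c →
      k ^ (a ⊓ b) * n ≤ (k + 1) ^ (a ⊓ b) * ((a ⊔ b) ∸ 1) * c ^ (a ⊓ b)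
theorem7p1 s t a b 2≤a a≤s 2≤b b≤t k = s + t + suc threshold , large
  where
  threshold : ℕ
  threshold = bicliqueBound (a ⊓ b) ((a ⊔ b) ∸ 1) (k * (a ⊓ b) * (a ⊓ b))
  1≤a : 1 ≤ a
  1≤a = ≤-trans (n≤1+n 1) 2≤a
  1≤b : 1 ≤ b
  1≤b = ≤-trans (n≤1+n 1) 2≤b
  large : ∀ n → s + t + suc threshold ≤ n → ∀ c → Colourable n s t (s * t ∸ a * b + 2) c →
    k ^ (a ⊓ b) * n ≤ (k + 1) ^ (a ⊓ b) * ((a ⊔ b) ∸ 1) * c ^ (a ⊓ b)
  large n N≤n c (χ , colouring) =
    eventually-bound k (⊓-glb 1≤a 1≤b) (∸-monoˡ-≤ 1 (≤-trans 2≤a (m≤m⊔n a b)))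
      (biclique-free⇒≤bicliqueBound-⊓⊔ χ 1≤a 1≤b (colouring⇒biclique-free a≤s b≤t s≤n t≤n colouring))
      (≤-trans (m≤n+m _ (s + t)) N≤n)
    where
    s+t≤n : s + t ≤ n
    s+t≤n = ≤-trans (m≤m+n (s + t) _) N≤n
    s≤n : s ≤ n
    s≤n = ≤-trans (m≤m+n s t) s+t≤n
    t≤n : t ≤ n
    t≤n = ≤-trans (m≤n+m t s) s+t≤n
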